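{- Let $M$ and $L$ be matroids on a finite non-empty set $E$, let $X=\{x_1,\ldots,x_k\}$ be a set of $k\ge 1$ distinct elements with $E\cap X=\emptyset$. Then the following are equivalent: (c1) there is a matroid $N$ on $E\cup X$ with $N/X=M$ and $N\setminus X=L$; (c2) there exists a sequence $(L_0,L_1,\ldots,L_k)$ of matroids on $E$ with $L_0=M$ and $L_k=L$ such that for each $1\le i\le k$ there is a matroid $N_i$ on $E\cup\{x_i\}$ with $N_i/\{x_i\}=L_{i-1}$ and $N_i\setminus\{x_i\}=L_i$.
   Context: $N/Z$ denotes contraction and $N\setminus Z$ deletion of a set $Z$ from a matroid $N$. A pair $(M,L)$ of matroids on $E$ for which such an $N$ exists is called an $X$-codeletion-deletion (quotient-lift) pair. -}

module Defs where

open import Data.Nat using (ℕ; _+_; _<_)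
open import Data.Fin using (Fin)
open import Data.Fin.Subset using (Subset; ⊥; _∈_; _∉_; _⊆_; _∪_; ⁅_⁆; ∣_∣)
open import Data.Vec using (_++_)
open import Data.Product using (Σ; ∃; _×_; _,_)
open import Relation.Unary using (Decidable)
open import Function.Bundles using (_⇔_)

-- Independence is required to be decidable,
-- which is automatic for finite matroids classically.
record Matroid (n : ℕ) : Set₁ where
  field
    Indep      : Subset n → Set
    indep?     : Decidable Indep
    indep-⊥    : Indep ⊥
    indep-↓    : ∀ {I J} → J ⊆ I → Indep I → Indep J
    augment    : ∀ {I J} → Indep I → Indep J → ∣ I ∣ < ∣ J ∣ →
                 Σ (Fin n) λ x → x ∈ J × x ∉ I × Indep (⁅ x ⁆ ∪ I)

open Matroid public

_≅_ : ∀ {n} → Matroid n → Matroid n → Set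
M ≅ L = ∀ I → Indep M I ⇔ Indep L I

-- Ground set E ∪ X is modelled as Fin (n + k): the first n elements are E,
-- the last k are X.  A subset is I ++ B with I ⊆ E and B ⊆ X.

IsBasisOfX : ∀ {n k} → Matroid (n + k) → Subset k → Set
IsBasisOfX {n} N B =
  Indep N (⊥ {n} ++ B) ×
  (∀ B′ → B ⊆ B′ → Indep N (⊥ {n} ++ B′) → B′ ⊆ B)

DelIndep : ∀ {n k} → Matroid (n + k) → Subset n → Set
DelIndep {n} {k} N I = Indep N (I ++ ⊥ {k})

ConIndep : ∀ {n k} → Matroid (n + k) → Subset n → Set
ConIndep N I = ∃ λ B → IsBasisOfX N B × Indep N (I ++ B)

DeletionIs : ∀ {n k} → Matroid (n + k) → Matroid n → Set
DeletionIs N L = ∀ I → DelIndep N I ⇔ Indep L I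

ContractionIs : ∀ {n k} → Matroid (n + k) → Matroid n → Set
ContractionIs N M = ∀ I → ConIndep N I ⇔ Indep M I

{-# OPTIONS --safe #-}

-- Both conditions are equivalent to: M is a quotient of L (cl_L ⊆ cl_M) and
-- |I| ≤ r_M(I) + k for every L-independent I.  For N/X = M and N\X = L this follows
-- from r_{N/X}(I) = r_N(I ∪ X) − r_N(X) and monotonicity of closure in N, and the
-- rank gaps add up along a chain.  Conversely such a quotient is realised by the
-- Higgs major on E ⊎ X, where I ∪ B is independent iff I is L-independent and
-- |I| + |B| ≤ r_M(I) + k; its contraction is M and its deletion L.  The Higgs lifts
-- H_a (I independent iff I is L-independent and |I| ≤ r_M(I) + a) form a chain
-- M = H_0, …, H_k = L; H_a and H_{a+1} are the contraction and deletion of the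
-- one-element Higgs major with bound a + 1.

module Submission where

open import Defs
open import Data.Nat using (ℕ; zero; suc; _+_; _≤_; _<_; _≥_; z≤n; s≤s; _≤?_; _<?_)
open import Data.Nat.Properties
open import Data.Fin using (Fin; zero; fromℕ; inject₁; toℕ; _↑ˡ_; _↑ʳ_; splitAt; join) renaming (suc to fsuc)
open import Data.Fin.Properties using (any?; join-splitAt; toℕ-fromℕ; toℕ-inject₁)
open import Data.Fin.Subset using (Subset; ⊥; ⊤; _∈_; _∉_; _⊆_; _∪_; _∩_; ⁅_⁆; ∣_∣; inside; outside)
open import Data.Fin.Subset.Properties
  using (_∈?_; ⊥⊆; ⊆⊤; ∣⊥∣≡0; ∣⊤∣≡n; ∣p∣≤n; x∈⁅x⁆; x∈⁅y⁆⇒x≡y; x∈p∪q⁺; x∈p∪q⁻; p⊆p∪q; q⊆p∪q;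
         ⊆-refl; ⊆-trans; ⊆-antisym; p∩q⊆p; p∩q⊆q; ∪-identityˡ; p⊆q⇒∣p∣≤∣q∣; p⊂q⇒∣p∣<∣q∣)
open import Data.Vec using ([]; _∷_; _++_; take; drop; here; there)
open import Data.Vec.Properties using (zipWith-++; take++drop≡id; ++-injectiveˡ; ++-injectiveʳ)
open import Data.Bool using (_∨_)
open import Data.Product using (Σ; ∃; _×_; _,_; proj₁; proj₂)
open import Data.Sum using (_⊎_; inj₁; inj₂; [_,_]; [_,_]′; map₁)
open import Data.Empty using (⊥-elim)
open import Function using (_∘_; id)
open import Function.Bundles using (_⇔_; mk⇔; Equivalence)
open import Function.Construct.Composition using (_⇔-∘_)
open import Relation.Nullary using (¬_; Dec; yes; no)
open import Relation.Nullary.Decidable using (_×-dec_; ¬?; decidable-stable)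
open import Relation.Binary.PropositionalEquality
open import Algebra.Properties.CommutativeSemigroup +-commutativeSemigroup
  using (x∙yz≈y∙xz; x∙yz≈yx∙z; x∙yz≈xz∙y; xy∙z≈y∙xz; xy∙z≈x∙zy)

open Equivalence using (to; from)

private variable
  n m : ℕ

x∉p⇒∣⁅x⁆∪p∣≡1+∣p∣ : {x : Fin n} {p : Subset n} → x ∉ p → ∣ ⁅ x ⁆ ∪ p ∣ ≡ suc ∣ p ∣
x∉p⇒∣⁅x⁆∪p∣≡1+∣p∣ {x = zero}   {inside ∷ p}  x∉p = ⊥-elim (x∉p here)
x∉p⇒∣⁅x⁆∪p∣≡1+∣p∣ {x = zero}   {outside ∷ p} x∉p = cong (λ q → suc ∣ q ∣) (∪-identityˡ p)
x∉p⇒∣⁅x⁆∪p∣≡1+∣p∣ {x = fsuc x} {inside ∷ p}  x∉p = cong suc (x∉p⇒∣⁅x⁆∪p∣≡1+∣p∣ (x∉p ∘ there))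
x∉p⇒∣⁅x⁆∪p∣≡1+∣p∣ {x = fsuc x} {outside ∷ p} x∉p = x∉p⇒∣⁅x⁆∪p∣≡1+∣p∣ (x∉p ∘ there)

insert-size : {x : Fin n} {p : Subset n} {r : ℕ} → x ∉ p → ∣ p ∣ ≡ r → ∣ ⁅ x ⁆ ∪ p ∣ ≡ suc r
insert-size x∉p ∣p∣≡r = trans (x∉p⇒∣⁅x⁆∪p∣≡1+∣p∣ x∉p) (cong suc ∣p∣≡r)

∣p∣+∣q∣≡∣p∩q∣+∣p∪q∣ : (p q : Subset n) → ∣ p ∣ + ∣ q ∣ ≡ ∣ p ∩ q ∣ + ∣ p ∪ q ∣
∣p∣+∣q∣≡∣p∩q∣+∣p∪q∣ []            []            = refl
∣p∣+∣q∣≡∣p∩q∣+∣p∪q∣ (inside ∷ p)  (inside ∷ q)  =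
  cong suc (trans (+-suc _ _) (trans (cong suc (∣p∣+∣q∣≡∣p∩q∣+∣p∪q∣ p q)) (sym (+-suc _ _))))
∣p∣+∣q∣≡∣p∩q∣+∣p∪q∣ (inside ∷ p)  (outside ∷ q) =
  trans (cong suc (∣p∣+∣q∣≡∣p∩q∣+∣p∪q∣ p q)) (sym (+-suc _ _))
∣p∣+∣q∣≡∣p∩q∣+∣p∪q∣ (outside ∷ p) (inside ∷ q)  =
  trans (+-suc _ _) (trans (cong suc (∣p∣+∣q∣≡∣p∩q∣+∣p∪q∣ p q)) (sym (+-suc _ _)))
∣p∣+∣q∣≡∣p∩q∣+∣p∪q∣ (outside ∷ p) (outside ∷ q) = ∣p∣+∣q∣≡∣p∩q∣+∣p∪q∣ p q

⊆⊎∃∖ : (p q : Subset n) → p ⊆ q ⊎ ∃ λ x → x ∈ p × x ∉ q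
⊆⊎∃∖ p q with any? (λ x → (x ∈? p) ×-dec ¬? (x ∈? q))
... | yes witness = inj₂ witness
... | no none     = inj₁ λ {x} x∈p → decidable-stable (x ∈? q) λ x∉q → none (x , x∈p , x∉q)

⊆∧∣∣≤⇒⊇ : {p q : Subset n} → p ⊆ q → ∣ q ∣ ≤ ∣ p ∣ → q ⊆ p
⊆∧∣∣≤⇒⊇ {p = p} {q} p⊆q ∣q∣≤∣p∣ with ⊆⊎∃∖ q p
... | inj₁ q⊆p = q⊆p
... | inj₂ x∈q∖p = ⊥-elim (<⇒≱ (p⊂q⇒∣p∣<∣q∣ (p⊆q , x∈q∖p)) ∣q∣≤∣p∣)

∣∣<⇒∃∖ : {p q : Subset n} → ∣ p ∣ < ∣ q ∣ → ∃ λ x → x ∈ q × x ∉ p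
∣∣<⇒∃∖ {p = p} {q} ∣p∣<∣q∣ with ⊆⊎∃∖ q p
... | inj₁ q⊆p = ⊥-elim (<⇒≱ ∣p∣<∣q∣ (p⊆q⇒∣p∣≤∣q∣ q⊆p))
... | inj₂ x∈q∖p = x∈q∖p

x∈⁅y⁆∪p⁻ : {x y : Fin n} {p : Subset n} → x ∈ ⁅ y ⁆ ∪ p → x ≡ y ⊎ x ∈ p
x∈⁅y⁆∪p⁻ {y = y} {p} x∈ = map₁ (x∈⁅y⁆⇒x≡y y) (x∈p∪q⁻ ⁅ y ⁆ p x∈)

x∈⁅x⁆∪p : (x : Fin n) {p : Subset n} → x ∈ ⁅ x ⁆ ∪ p
x∈⁅x⁆∪p x = x∈p∪q⁺ (inj₁ (x∈⁅x⁆ x))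

x∈p⇒x∈⁅y⁆∪p : (y : Fin n) {p : Subset n} {x : Fin n} → x ∈ p → x ∈ ⁅ y ⁆ ∪ p
x∈p⇒x∈⁅y⁆∪p y x∈p = x∈p∪q⁺ (inj₂ x∈p)

⁅x⁆∪p⊆q : {x : Fin n} {p q : Subset n} → x ∈ q → p ⊆ q → ⁅ x ⁆ ∪ p ⊆ q
⁅x⁆∪p⊆q x∈q p⊆q y∈ with x∈⁅y⁆∪p⁻ y∈
... | inj₁ refl = x∈q
... | inj₂ y∈p  = p⊆q y∈p

⁅x⁆∪-monoʳ : {x : Fin n} {p q : Subset n} → p ⊆ q → ⁅ x ⁆ ∪ p ⊆ ⁅ x ⁆ ∪ q
⁅x⁆∪-monoʳ {x = x} p⊆q = ⁅x⁆∪p⊆q (x∈⁅x⁆∪p x) (x∈p⇒x∈⁅y⁆∪p x ∘ p⊆q)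

↑-elim : ∀ n {m} {P : Fin (n + m) → Set} → (∀ x → P (x ↑ˡ m)) → (∀ y → P (n ↑ʳ y)) → ∀ z → P z
↑-elim n {m} {P} left right z =
  subst P (join-splitAt n m z) ([_,_] {C = P ∘ join n m} left right (splitAt n z))

∈-++⁺ˡ : ∀ {x : Fin n} {p} {q : Subset m} → x ∈ p → x ↑ˡ m ∈ p ++ q
∈-++⁺ˡ here      = here
∈-++⁺ˡ (there h) = there (∈-++⁺ˡ h)

∈-++⁻ˡ : ∀ {x : Fin n} {p} {q : Subset m} → x ↑ˡ m ∈ p ++ q → x ∈ p
∈-++⁻ˡ {x = zero}   {inside ∷ _} here      = here
∈-++⁻ˡ {x = fsuc x} {_ ∷ _}      (there h) = there (∈-++⁻ˡ h)

∈-++⁺ʳ : ∀ (p : Subset n) {y : Fin m} {q} → y ∈ q → n ↑ʳ y ∈ p ++ q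
∈-++⁺ʳ []      h = h
∈-++⁺ʳ (_ ∷ p) h = there (∈-++⁺ʳ p h)

∈-++⁻ʳ : ∀ (p : Subset n) {y : Fin m} {q} → n ↑ʳ y ∈ p ++ q → y ∈ q
∈-++⁻ʳ []      h         = h
∈-++⁻ʳ (_ ∷ p) (there h) = ∈-++⁻ʳ p h

++-mono-⊆ : ∀ {p p′ : Subset n} {q q′ : Subset m} → p ⊆ p′ → q ⊆ q′ → p ++ q ⊆ p′ ++ q′
++-mono-⊆ {n} {p = p} {p′} {q} {q′} p⊆p′ q⊆q′ {z} = ↑-elim n {P = λ z → z ∈ p ++ q → z ∈ p′ ++ q′}
  (λ x → ∈-++⁺ˡ ∘ p⊆p′ ∘ ∈-++⁻ˡ) (λ y → ∈-++⁺ʳ p′ ∘ q⊆q′ ∘ ∈-++⁻ʳ p) z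

++-⊆⁻ : ∀ {p p′ : Subset n} {q q′ : Subset m} → p ++ q ⊆ p′ ++ q′ → p ⊆ p′ × q ⊆ q′
++-⊆⁻ {p = p} {p′} pq⊆ = ∈-++⁻ˡ ∘ pq⊆ ∘ ∈-++⁺ˡ , ∈-++⁻ʳ p′ ∘ pq⊆ ∘ ∈-++⁺ʳ p

∣p++q∣≡∣p∣+∣q∣ : ∀ (p : Subset n) (q : Subset m) → ∣ p ++ q ∣ ≡ ∣ p ∣ + ∣ q ∣
∣p++q∣≡∣p∣+∣q∣ []            q = refl
∣p++q∣≡∣p∣+∣q∣ (inside ∷ p)  q = cong suc (∣p++q∣≡∣p∣+∣q∣ p q)
∣p++q∣≡∣p∣+∣q∣ (outside ∷ p) q = ∣p++q∣≡∣p∣+∣q∣ p q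

++-∪ : ∀ (p p′ : Subset n) (q q′ : Subset m) → (p ++ q) ∪ (p′ ++ q′) ≡ (p ∪ p′) ++ (q ∪ q′)
++-∪ p p′ q q′ = zipWith-++ _∨_ p q p′ q′

⊥++⊥ : ⊥ {n} ++ ⊥ {m} ≡ ⊥
⊥++⊥ {zero}  = refl
⊥++⊥ {suc n} = cong (outside ∷_) (⊥++⊥ {n = n})

⁅x↑ˡ⁆≡⁅x⁆++⊥ : ∀ {n m} (x : Fin n) → ⁅ x ↑ˡ m ⁆ ≡ ⁅ x ⁆ ++ ⊥
⁅x↑ˡ⁆≡⁅x⁆++⊥ {suc n} zero     = cong (inside ∷_) (sym (⊥++⊥ {n = n}))
⁅x↑ˡ⁆≡⁅x⁆++⊥ {suc n} (fsuc x) = cong (outside ∷_) (⁅x↑ˡ⁆≡⁅x⁆++⊥ x)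

⁅↑ʳy⁆≡⊥++⁅y⁆ : ∀ n (y : Fin m) → ⁅ n ↑ʳ y ⁆ ≡ ⊥ ++ ⁅ y ⁆
⁅↑ʳy⁆≡⊥++⁅y⁆ zero    y = refl
⁅↑ʳy⁆≡⊥++⁅y⁆ (suc n) y = cong (outside ∷_) (⁅↑ʳy⁆≡⊥++⁅y⁆ n y)

⁅x↑ˡ⁆∪p++q : ∀ (x : Fin n) (p : Subset n) (q : Subset m) → ⁅ x ↑ˡ m ⁆ ∪ (p ++ q) ≡ (⁅ x ⁆ ∪ p) ++ q
⁅x↑ˡ⁆∪p++q x p q = begin
  ⁅ x ↑ˡ _ ⁆ ∪ (p ++ q)      ≡⟨ cong (_∪ (p ++ q)) (⁅x↑ˡ⁆≡⁅x⁆++⊥ x) ⟩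
  (⁅ x ⁆ ++ ⊥) ∪ (p ++ q)    ≡⟨ ++-∪ ⁅ x ⁆ p ⊥ q ⟩
  (⁅ x ⁆ ∪ p) ++ (⊥ ∪ q)     ≡⟨ cong ((⁅ x ⁆ ∪ p) ++_) (∪-identityˡ q) ⟩
  (⁅ x ⁆ ∪ p) ++ q           ∎
  where open ≡-Reasoning

⁅↑ʳy⁆∪p++q : ∀ (y : Fin m) (p : Subset n) (q : Subset m) → ⁅ n ↑ʳ y ⁆ ∪ (p ++ q) ≡ p ++ (⁅ y ⁆ ∪ q)
⁅↑ʳy⁆∪p++q {n = n} y p q = begin
  ⁅ n ↑ʳ y ⁆ ∪ (p ++ q)      ≡⟨ cong (_∪ (p ++ q)) (⁅↑ʳy⁆≡⊥++⁅y⁆ n y) ⟩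
  (⊥ ++ ⁅ y ⁆) ∪ (p ++ q)    ≡⟨ ++-∪ ⊥ p ⁅ y ⁆ q ⟩
  (⊥ ∪ p) ++ (⁅ y ⁆ ∪ q)     ≡⟨ cong (_++ (⁅ y ⁆ ∪ q)) (∪-identityˡ p) ⟩
  p ++ (⁅ y ⁆ ∪ q)           ∎
  where open ≡-Reasoning

take-++ : ∀ (p : Subset n) (q : Subset m) → take n (p ++ q) ≡ p
take-++ {n} p q = ++-injectiveˡ (take n (p ++ q)) p (take++drop≡id n (p ++ q))

drop-++ : ∀ (p : Subset n) (q : Subset m) → drop n (p ++ q) ≡ q
drop-++ {n} p q = ++-injectiveʳ (take n (p ++ q)) p (take++drop≡id n (p ++ q))

take-drop-mono-⊆ : ∀ {S T : Subset (n + m)} → S ⊆ T → take n S ⊆ take n T × drop n S ⊆ drop n T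
take-drop-mono-⊆ {n} {S = S} {T} S⊆T = ++-⊆⁻
  (λ x∈ → subst (_ ∈_) (sym (take++drop≡id n T)) (S⊆T (subst (_ ∈_) (take++drop≡id n S) x∈)))

∈-take⁺ : ∀ {x : Fin n} (S : Subset (n + m)) → x ↑ˡ m ∈ S → x ∈ take n S
∈-take⁺ {n} S h = ∈-++⁻ˡ (subst (_ ∈_) (sym (take++drop≡id n S)) h)

∈-take⁻ : ∀ {x : Fin n} (S : Subset (n + m)) → x ∈ take n S → x ↑ˡ m ∈ S
∈-take⁻ {n} S h = subst (_ ∈_) (take++drop≡id n S) (∈-++⁺ˡ h)

∈-drop⁺ : ∀ {y : Fin m} (S : Subset (n + m)) → n ↑ʳ y ∈ S → y ∈ drop n S
∈-drop⁺ {n = n} S h = ∈-++⁻ʳ (take n S) (subst (_ ∈_) (sym (take++drop≡id n S)) h)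

∈-drop⁻ : ∀ {y : Fin m} (S : Subset (n + m)) → y ∈ drop n S → n ↑ʳ y ∈ S
∈-drop⁻ {n = n} S h = subst (_ ∈_) (take++drop≡id n S) (∈-++⁺ʳ (take n S) h)

∣S∣≡∣take∣+∣drop∣ : ∀ n (S : Subset (n + m)) → ∣ S ∣ ≡ ∣ take n S ∣ + ∣ drop n S ∣
∣S∣≡∣take∣+∣drop∣ n S = trans (cong ∣_∣ (sym (take++drop≡id n S))) (∣p++q∣≡∣p∣+∣q∣ (take n S) (drop n S))

module Rank (N : Matroid n) where

  extend : ∀ {A J} → Indep N A → Indep N J →
           Σ (Subset n) λ K → A ⊆ K × K ⊆ A ∪ J × Indep N K × ∣ J ∣ ≤ ∣ K ∣
  extend {A} {J} iA iJ = go ∣ J ∣ A iA ⊆-refl (p⊆p∪q J) (m≤m+n ∣ J ∣ ∣ A ∣)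
    where
    go : (fuel : ℕ) (B : Subset n) → Indep N B → A ⊆ B → B ⊆ A ∪ J → ∣ J ∣ ≤ fuel + ∣ B ∣ →
         Σ (Subset n) λ K → A ⊆ K × K ⊆ A ∪ J × Indep N K × ∣ J ∣ ≤ ∣ K ∣
    go fuel B iB A⊆B B⊆A∪J bound with ∣ J ∣ ≤? ∣ B ∣
    ... | yes done = B , A⊆B , B⊆A∪J , iB , done
    go zero       B iB A⊆B B⊆A∪J bound | no short = ⊥-elim (short bound)
    go (suc fuel) B iB A⊆B B⊆A∪J bound | no short with augment N iB iJ (≰⇒> short)
    ... | x , x∈J , x∉B , iX =
      go fuel (⁅ x ⁆ ∪ B) iX (x∈p⇒x∈⁅y⁆∪p x ∘ A⊆B) (⁅x⁆∪p⊆q (q⊆p∪q A J x∈J) B⊆A∪J)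
         (subst (∣ J ∣ ≤_) (trans (sym (+-suc fuel ∣ B ∣))
                                  (cong (fuel +_) (sym (x∉p⇒∣⁅x⁆∪p∣≡1+∣p∣ x∉B)))) bound)

  IsMaxIndepIn : Subset n → Subset n → Set
  IsMaxIndepIn S T = T ⊆ S × Indep N T × (∀ {U} → U ⊆ S → Indep N U → ∣ U ∣ ≤ ∣ T ∣)

  maxIndepIn : (S : Subset n) → Σ (Subset n) (IsMaxIndepIn S)
  maxIndepIn S = go n ⊥ ⊥⊆ (indep-⊥ N) (m≤m+n n ∣ ⊥ {n} ∣)
    where
    go : (fuel : ℕ) (T : Subset n) → T ⊆ S → Indep N T → n ≤ fuel + ∣ T ∣ → Σ (Subset n) (IsMaxIndepIn S)
    go zero T T⊆S iT bound = T , T⊆S , iT , λ {U} _ _ → ≤-trans (∣p∣≤n U) bound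
    go (suc fuel) T T⊆S iT bound
      with any? (λ x → (x ∈? S) ×-dec ¬? (x ∈? T) ×-dec indep? N (⁅ x ⁆ ∪ T))
    ... | yes (x , x∈S , x∉T , iX) =
      go fuel (⁅ x ⁆ ∪ T) (⁅x⁆∪p⊆q x∈S T⊆S) iX
         (subst (n ≤_) (trans (sym (+-suc fuel ∣ T ∣))
                              (cong (fuel +_) (sym (x∉p⇒∣⁅x⁆∪p∣≡1+∣p∣ x∉T)))) bound)
    ... | no none = T , T⊆S , iT , λ U⊆S iU → ≮⇒≥ λ ∣T∣<∣U∣ →
      let x , x∈U , x∉T , iX = augment N iT iU ∣T∣<∣U∣ in none (x , U⊆S x∈U , x∉T , iX)

  rank : Subset n → ℕ
  rank S = ∣ proj₁ (maxIndepIn S) ∣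

  indep-⊆⇒∣∣≤rank : ∀ {U S} → U ⊆ S → Indep N U → ∣ U ∣ ≤ rank S
  indep-⊆⇒∣∣≤rank {S = S} = proj₂ (proj₂ (proj₂ (maxIndepIn S)))

  rank-witness : ∀ S → Σ (Subset n) λ T → T ⊆ S × Indep N T × ∣ T ∣ ≡ rank S
  rank-witness S = let T , T⊆S , iT , _ = maxIndepIn S in T , T⊆S , iT , refl

  rank-mono : ∀ {S S′} → S ⊆ S′ → rank S ≤ rank S′
  rank-mono {S} S⊆S′ = let T , T⊆S , iT , _ = maxIndepIn S in indep-⊆⇒∣∣≤rank (⊆-trans T⊆S S⊆S′) iT

  rank≤∣∣ : ∀ S → rank S ≤ ∣ S ∣
  rank≤∣∣ S = p⊆q⇒∣p∣≤∣q∣ (proj₁ (proj₂ (maxIndepIn S)))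

  indep⇒rank≡∣∣ : ∀ {S} → Indep N S → rank S ≡ ∣ S ∣
  indep⇒rank≡∣∣ {S} iS = ≤-antisym (rank≤∣∣ S) (indep-⊆⇒∣∣≤rank ⊆-refl iS)

  dep⇒rank<∣∣ : ∀ {S} → ¬ Indep N S → rank S < ∣ S ∣
  dep⇒rank<∣∣ {S} dep = ≤∧≢⇒< (rank≤∣∣ S) λ rank≡∣S∣ →
    let T , T⊆S , iT , ∣T∣≡rank = rank-witness S in
    dep (indep-↓ N (⊆∧∣∣≤⇒⊇ T⊆S (≤-reflexive (sym (trans ∣T∣≡rank rank≡∣S∣)))) iT)

  ∣∣≤rank⇒indep : ∀ {S} → ∣ S ∣ ≤ rank S → Indep N S
  ∣∣≤rank⇒indep {S} ∣S∣≤rank = decidable-stable (indep? N S) λ dep → <⇒≱ (dep⇒rank<∣∣ dep) ∣S∣≤rank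

  rank-witness-maximal : ∀ {S T x} → T ⊆ S → ∣ T ∣ ≡ rank S → x ∈ S → x ∉ T → ¬ Indep N (⁅ x ⁆ ∪ T)
  rank-witness-maximal T⊆S ∣T∣≡rank x∈S x∉T iX =
    <⇒≱ (≤-reflexive (sym (insert-size x∉T ∣T∣≡rank)))
        (indep-⊆⇒∣∣≤rank (⁅x⁆∪p⊆q x∈S T⊆S) iX)

  rank-augment : ∀ {I J} → rank I < rank J → ∃ λ e → e ∈ J × e ∉ I × rank I < rank (⁅ e ⁆ ∪ I)
  rank-augment {I} {J} rankI<rankJ with rank-witness I | rank-witness J
  ... | T , T⊆I , iT , ∣T∣≡rankI | U , U⊆J , iU , ∣U∣≡rankJ
    with augment N iT iU (subst₂ _<_ (sym ∣T∣≡rankI) (sym ∣U∣≡rankJ) rankI<rankJ)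
  ... | e , e∈U , e∉T , iX = e , U⊆J e∈U , e∉I , rankI<
    where
    e∉I : e ∉ I
    e∉I e∈I = rank-witness-maximal T⊆I ∣T∣≡rankI e∈I e∉T iX
    rankI< : rank I < rank (⁅ e ⁆ ∪ I)
    rankI< = subst (_≤ rank (⁅ e ⁆ ∪ I)) (insert-size e∉T ∣T∣≡rankI)
                   (indep-⊆⇒∣∣≤rank (⁅x⁆∪-monoʳ T⊆I) iX)

  rank-growth≤card-growth : ∀ {J I} → J ⊆ I → rank I + ∣ J ∣ ≤ rank J + ∣ I ∣
  rank-growth≤card-growth {J} {I} J⊆I with rank-witness I
  ... | T , T⊆I , iT , ∣T∣≡rankI = begin
      rank I + ∣ J ∣          ≡⟨ cong (_+ ∣ J ∣) (sym ∣T∣≡rankI) ⟩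
      ∣ T ∣ + ∣ J ∣           ≡⟨ ∣p∣+∣q∣≡∣p∩q∣+∣p∪q∣ T J ⟩
      ∣ T ∩ J ∣ + ∣ T ∪ J ∣   ≤⟨ +-mono-≤ (indep-⊆⇒∣∣≤rank (p∩q⊆q T J) (indep-↓ N (p∩q⊆p T J) iT))
                                          (p⊆q⇒∣p∣≤∣q∣ ([ T⊆I , J⊆I ]′ ∘ x∈p∪q⁻ T J)) ⟩
      rank J + ∣ I ∣          ∎
    where open ≤-Reasoning

  _∈cl_ : Fin n → Subset n → Set
  e ∈cl S = rank (⁅ e ⁆ ∪ S) ≤ rank S

  dep-insert⇒∈cl : ∀ {e I} → Indep N I → e ∉ I → ¬ Indep N (⁅ e ⁆ ∪ I) → e ∈cl I
  dep-insert⇒∈cl {e} {I} iI e∉I dep =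
    ≤-pred (subst (rank (⁅ e ⁆ ∪ I) <_) (insert-size e∉I (sym (indep⇒rank≡∣∣ iI))) (dep⇒rank<∣∣ dep))

  ∉cl⇒insert-indep : ∀ {e S T} → T ⊆ S → Indep N T → ∣ T ∣ ≡ rank S → ¬ e ∈cl S →
                     e ∉ S × Indep N (⁅ e ⁆ ∪ T)
  ∉cl⇒insert-indep {e} {S} {T} T⊆S iT ∣T∣≡rankS e∉clS with rank-witness (⁅ e ⁆ ∪ S)
  ... | U , U⊆ , iU , ∣U∣≡rank
    with augment N iT iU (subst₂ _<_ (sym ∣T∣≡rankS) (sym ∣U∣≡rank) (≰⇒> e∉clS))
  ... | x , x∈U , x∉T , iX with x∈⁅y⁆∪p⁻ (U⊆ x∈U)
  ... | inj₂ x∈S  = ⊥-elim (rank-witness-maximal T⊆S ∣T∣≡rankS x∈S x∉T iX)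
  ... | inj₁ refl = (λ e∈S → rank-witness-maximal T⊆S ∣T∣≡rankS e∈S x∉T iX) , iX

  ∈cl-mono : ∀ {e I S} → I ⊆ S → e ∈cl I → e ∈cl S
  ∈cl-mono {e} {I} {S} I⊆S e∈clI = decidable-stable (_ ≤? _) refute
    where
    refute : ¬ ¬ e ∈cl S
    refute e∉clS with rank-witness S
    ... | T , T⊆S , iT , ∣T∣≡rankS with ∉cl⇒insert-indep T⊆S iT ∣T∣≡rankS e∉clS | rank-witness I
    ... | e∉S , iX | TI , TI⊆I , iTI , ∣TI∣≡rankI with extend iTI iX
    ... | K , TI⊆K , K⊆ , iK , ∣⁅e⁆∪T∣≤∣K∣ with e ∈? K
    ... | yes e∈K = <⇒≱ (≤-reflexive (sym (insert-size (e∉S ∘ I⊆S ∘ TI⊆I) ∣TI∣≡rankI)))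
        (≤-trans (indep-⊆⇒∣∣≤rank (⁅x⁆∪-monoʳ TI⊆I) (indep-↓ N (⁅x⁆∪p⊆q e∈K TI⊆K) iK)) e∈clI)
    ... | no e∉K = <⇒≱ (≤-trans (≤-reflexive (sym (insert-size (e∉S ∘ T⊆S) ∣T∣≡rankS))) ∣⁅e⁆∪T∣≤∣K∣)
        (indep-⊆⇒∣∣≤rank K⊆S iK)
      where
      K⊆S : K ⊆ S
      K⊆S x∈K with x∈p∪q⁻ TI _ (K⊆ x∈K)
      ... | inj₁ x∈TI = I⊆S (TI⊆I x∈TI)
      ... | inj₂ x∈⁅e⁆∪T with x∈⁅y⁆∪p⁻ x∈⁅e⁆∪T
      ... | inj₁ refl = ⊥-elim (e∉K x∈K)
      ... | inj₂ x∈T  = T⊆S x∈T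

open Rank using (rank; rank-witness; indep-⊆⇒∣∣≤rank)

indep⊆⇒rank≤ : {A B : Matroid n} → (∀ {I} → Indep A I → Indep B I) → ∀ S → rank A S ≤ rank B S
indep⊆⇒rank≤ {A = A} {B} A⇒B S =
  let T , T⊆S , iT , ∣T∣≡rank = rank-witness A S in
  subst (_≤ rank B S) ∣T∣≡rank (indep-⊆⇒∣∣≤rank B T⊆S (A⇒B iT))

≅⇒rank≡ : {A B : Matroid n} → A ≅ B → ∀ S → rank A S ≡ rank B S
≅⇒rank≡ A≅B S = ≤-antisym (indep⊆⇒rank≤ (to (A≅B _)) S) (indep⊆⇒rank≤ (from (A≅B _)) S)

ClosureIncluded : Matroid n → Matroid n → Set
ClosureIncluded L M = ∀ {e S} → Rank._∈cl_ L e S → Rank._∈cl_ M e S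

record Quotient (L M : Matroid n) (d : ℕ) : Set where
  field
    indep⇒indep : ∀ {I} → Indep M I → Indep L I
    closure⊆    : ClosureIncluded L M
    ∣∣≤rank+d   : ∀ {I} → Indep L I → ∣ I ∣ ≤ rank M I + d

open Quotient

Quotient-refl : (M : Matroid n) → Quotient M M 0
Quotient-refl M = record
  { indep⇒indep = λ iI → iI
  ; closure⊆    = λ e∈cl → e∈cl
  ; ∣∣≤rank+d   = λ iI → ≤-reflexive (trans (sym (Rank.indep⇒rank≡∣∣ M iI)) (sym (+-identityʳ _)))
  }

Quotient-trans : ∀ {d₁ d₂} {A B C : Matroid n} → Quotient A B d₁ → Quotient B C d₂ → Quotient A C (d₁ + d₂)
Quotient-trans {d₁ = d₁} {d₂} {A} {B} {C} q₁ q₂ = record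
  { indep⇒indep = indep⇒indep q₁ ∘ indep⇒indep q₂
  ; closure⊆    = closure⊆ q₂ ∘ closure⊆ q₁
  ; ∣∣≤rank+d   = size-bound
  }
  where
  size-bound : ∀ {I} → Indep A I → ∣ I ∣ ≤ rank C I + (d₁ + d₂)
  size-bound {I} iI = let T , T⊆I , iT , ∣T∣≡rank = rank-witness B I in begin
    ∣ I ∣                  ≤⟨ ∣∣≤rank+d q₁ iI ⟩
    rank B I + d₁          ≡⟨ cong (_+ d₁) (sym ∣T∣≡rank) ⟩
    ∣ T ∣ + d₁             ≤⟨ +-monoˡ-≤ d₁ (∣∣≤rank+d q₂ iT) ⟩
    rank C T + d₂ + d₁     ≤⟨ +-monoˡ-≤ d₁ (+-monoˡ-≤ d₂ (Rank.rank-mono C T⊆I)) ⟩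
    rank C I + d₂ + d₁     ≡⟨ xy∙z≈x∙zy (rank C I) d₂ d₁ ⟩
    rank C I + (d₁ + d₂)   ∎
    where open ≤-Reasoning

Quotient-resp-≅ : ∀ {d} {L L′ M M′ : Matroid n} → L ≅ L′ → M ≅ M′ → Quotient L M d → Quotient L′ M′ d
Quotient-resp-≅ {d = d} L≅L′ M≅M′ q = record
  { indep⇒indep = λ {I} → to (L≅L′ I) ∘ indep⇒indep q ∘ from (M≅M′ I)
  ; closure⊆    = λ {e} {S} → subst₂ _≤_ (≅⇒rank≡ M≅M′ _) (≅⇒rank≡ M≅M′ S) ∘ closure⊆ q
                                ∘ subst₂ _≤_ (sym (≅⇒rank≡ L≅L′ _)) (sym (≅⇒rank≡ L≅L′ S))
  ; ∣∣≤rank+d   = λ {I} → subst (λ r → ∣ I ∣ ≤ r + d) (≅⇒rank≡ M≅M′ I) ∘ ∣∣≤rank+d q ∘ from (L≅L′ I)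
  }

Quotient-chain : ∀ k (Ls : Fin (suc k) → Matroid n) →
  (∀ i → Quotient (Ls (fsuc i)) (Ls (inject₁ i)) 1) → Quotient (Ls (fromℕ k)) (Ls zero) k
Quotient-chain zero    Ls steps = Quotient-refl (Ls zero)
Quotient-chain (suc k) Ls steps =
  Quotient-trans (steps (fromℕ k)) (Quotient-chain k (Ls ∘ inject₁) (steps ∘ inject₁))

module Higgs (L M : Matroid n) (cl⊆ : ClosureIncluded L M) where
  open Rank M using (rank-mono; rank-augment; rank-growth≤card-growth)

  LiftIndep : ℕ → Subset n → Subset m → Set
  LiftIndep a I B = Indep L I × ∣ I ∣ + ∣ B ∣ ≤ rank M I + a

  LiftIndep? : ∀ a I (B : Subset m) → Dec (LiftIndep a I B)
  LiftIndep? a I B = indep? L I ×-dec (_ ≤? _)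

  LiftIndep-⊥ : ∀ a → LiftIndep a ⊥ (⊥ {m})
  LiftIndep-⊥ {m} a = indep-⊥ L , subst (_≤ rank M ⊥ + a) (sym (cong₂ _+_ (∣⊥∣≡0 n) (∣⊥∣≡0 m))) z≤n

  LiftIndep-↓ : ∀ {a I J} {B C : Subset m} → J ⊆ I → C ⊆ B → LiftIndep a I B → LiftIndep a J C
  LiftIndep-↓ {a = a} {I} {J} {B} {C} J⊆I C⊆B (iI , bound) =
    indep-↓ L J⊆I iI , +-cancelˡ-≤ ∣ I ∣ _ _ (begin
      ∣ I ∣ + (∣ J ∣ + ∣ C ∣) ≤⟨ +-monoʳ-≤ ∣ I ∣ (+-monoʳ-≤ ∣ J ∣ (p⊆q⇒∣p∣≤∣q∣ C⊆B)) ⟩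
      ∣ I ∣ + (∣ J ∣ + ∣ B ∣) ≡⟨ x∙yz≈y∙xz (∣ I ∣) (∣ J ∣) (∣ B ∣) ⟩
      ∣ J ∣ + (∣ I ∣ + ∣ B ∣) ≤⟨ +-monoʳ-≤ ∣ J ∣ bound ⟩
      ∣ J ∣ + (rank M I + a)   ≡⟨ x∙yz≈yx∙z (∣ J ∣) (rank M I) a ⟩
      rank M I + ∣ J ∣ + a     ≤⟨ +-monoˡ-≤ a (rank-growth≤card-growth J⊆I) ⟩
      rank M J + ∣ I ∣ + a     ≡⟨ xy∙z≈y∙xz (rank M J) (∣ I ∣) a ⟩
      ∣ I ∣ + (rank M J + a)   ∎)
    where open ≤-Reasoning

  rank-increase⇒insert-indep : ∀ {e I} → Indep L I → e ∉ I → rank M I < rank M (⁅ e ⁆ ∪ I) →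
                               Indep L (⁅ e ⁆ ∪ I)
  rank-increase⇒insert-indep iI e∉I rank< = decidable-stable (indep? L _) λ dep →
    <⇒≱ rank< (cl⊆ (Rank.dep-insert⇒∈cl L iI e∉I dep))

  -- A tight bound forces r_M(I) < r_M(J); an element raising r_M(I) lies outside
  -- cl_M(I) ⊇ cl_L(I), so it can be added to I in L.
  LiftIndep-augment-tight : ∀ {a I J} {B C : Subset m} → LiftIndep a I B → LiftIndep a J C →
    ∣ I ∣ + ∣ B ∣ < ∣ J ∣ + ∣ C ∣ → rank M I + a ≤ ∣ I ∣ + ∣ B ∣ →
    ∃ λ x → x ∈ J × x ∉ I × LiftIndep a (⁅ x ⁆ ∪ I) B
  LiftIndep-augment-tight {a = a} {I} {J} {B} (iI , boundI) (_ , boundJ) ∣IB∣<∣JC∣ tight =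
    let e , e∈J , e∉I , rank< =
          rank-augment (+-cancelʳ-< a _ _ (≤-<-trans tight (<-≤-trans ∣IB∣<∣JC∣ boundJ)))
    in e , e∈J , e∉I , rank-increase⇒insert-indep iI e∉I rank< ,
       subst (λ s → s + ∣ B ∣ ≤ rank M (⁅ e ⁆ ∪ I) + a) (sym (x∉p⇒∣⁅x⁆∪p∣≡1+∣p∣ e∉I))
             (≤-trans (s≤s boundI) (+-monoˡ-≤ a rank<))

  LiftIndep-augment : ∀ {a I J} {B C : Subset m} → LiftIndep a I B → LiftIndep a J C →
    ∣ I ∣ + ∣ B ∣ < ∣ J ∣ + ∣ C ∣ →
    (∃ λ x → x ∈ J × x ∉ I × LiftIndep a (⁅ x ⁆ ∪ I) B) ⊎
    (∃ λ y → y ∈ C × y ∉ B × LiftIndep a I (⁅ y ⁆ ∪ B))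
  LiftIndep-augment {a = a} {I} {J} {B} {C} liI@(iI , _) liJ@(iJ , _) ∣IB∣<∣JC∣
    with ∣ I ∣ + ∣ B ∣ <? rank M I + a
  ... | no tight = inj₁ (LiftIndep-augment-tight {B = B} {C} liI liJ ∣IB∣<∣JC∣ (≮⇒≥ tight))
  ... | yes slack with ∣ B ∣ <? ∣ C ∣
  ... | yes ∣B∣<∣C∣ = let y , y∈C , y∉B = ∣∣<⇒∃∖ ∣B∣<∣C∣ in
    inj₂ (y , y∈C , y∉B , iI ,
          subst (_≤ rank M I + a) (sym (trans (cong (∣ I ∣ +_) (x∉p⇒∣⁅x⁆∪p∣≡1+∣p∣ y∉B)) (+-suc _ _))) slack)
  ... | no ∣B∣≮∣C∣ with augment L iI iJ (≰⇒> λ ∣J∣≤∣I∣ → <⇒≱ ∣IB∣<∣JC∣ (+-mono-≤ ∣J∣≤∣I∣ (≮⇒≥ ∣B∣≮∣C∣)))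
  ... | x , x∈J , x∉I , iX = inj₁ (x , x∈J , x∉I , iX ,
    subst (λ s → s + ∣ B ∣ ≤ rank M (⁅ x ⁆ ∪ I) + a) (sym (x∉p⇒∣⁅x⁆∪p∣≡1+∣p∣ x∉I))
          (≤-trans slack (+-monoˡ-≤ a (rank-mono (q⊆p∪q ⁅ x ⁆ I)))))

  higgsLift : ℕ → Matroid n
  higgsLift a = record
    { Indep   = λ I → LiftIndep a I []
    ; indep?  = λ I → LiftIndep? a I []
    ; indep-⊥ = LiftIndep-⊥ {0} a
    ; indep-↓ = λ J⊆I → LiftIndep-↓ {B = []} J⊆I ⊆-refl
    ; augment = λ {I} {J} liI liJ ∣I∣<∣J∣ → [ id , (λ { (() , _) }) ]′
        (LiftIndep-augment {B = []} {C = []} liI liJ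
          (subst₂ _<_ (sym (+-identityʳ ∣ I ∣)) (sym (+-identityʳ ∣ J ∣)) ∣I∣<∣J∣))
    }

  MajorIndep : ∀ m → ℕ → Subset (n + m) → Set
  MajorIndep m a S = LiftIndep a (take n S) (drop n S)

  LiftIndep⇒MajorIndep : ∀ {a S p} {q : Subset m} → S ≡ p ++ q → LiftIndep a p q → MajorIndep m a S
  LiftIndep⇒MajorIndep {a = a} {p = p} {q} refl =
    subst₂ (LiftIndep a) (sym (take-++ p q)) (sym (drop-++ p q))

  MajorIndep⇒LiftIndep : ∀ {a p} {q : Subset m} → MajorIndep m a (p ++ q) → LiftIndep a p q
  MajorIndep⇒LiftIndep {a = a} {p} {q} = subst₂ (LiftIndep a) (take-++ p q) (drop-++ p q)

  higgsMajor : (m j : ℕ) → Matroid (n + m)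
  higgsMajor m j = record
    { Indep   = MajorIndep m (m + j)
    ; indep?  = λ S → LiftIndep? (m + j) (take n S) (drop n S)
    ; indep-⊥ = LiftIndep⇒MajorIndep (sym (⊥++⊥ {n = n})) (LiftIndep-⊥ {m} (m + j))
    ; indep-↓ = λ J⊆I → let take⊆ , drop⊆ = take-drop-mono-⊆ J⊆I in LiftIndep-↓ take⊆ drop⊆
    ; augment = augment-major
    }
    where
    augment-major : ∀ {I J} → MajorIndep m (m + j) I → MajorIndep m (m + j) J → ∣ I ∣ < ∣ J ∣ →
                    Σ (Fin (n + m)) λ z → z ∈ J × z ∉ I × MajorIndep m (m + j) (⁅ z ⁆ ∪ I)
    augment-major {I} {J} liI liJ ∣I∣<∣J∣
      with LiftIndep-augment liI liJ (subst₂ _<_ (∣S∣≡∣take∣+∣drop∣ n I) (∣S∣≡∣take∣+∣drop∣ n J) ∣I∣<∣J∣)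
    ... | inj₁ (x , x∈ , x∉ , li) = x ↑ˡ m , ∈-take⁻ J x∈ , x∉ ∘ ∈-take⁺ I ,
      LiftIndep⇒MajorIndep (trans (cong (⁅ x ↑ˡ m ⁆ ∪_) (sym (take++drop≡id n I))) (⁅x↑ˡ⁆∪p++q x _ _)) li
    ... | inj₂ (y , y∈ , y∉ , li) = n ↑ʳ y , ∈-drop⁻ J y∈ , y∉ ∘ ∈-drop⁺ I ,
      LiftIndep⇒MajorIndep (trans (cong (⁅ n ↑ʳ y ⁆ ∪_) (sym (take++drop≡id n I))) (⁅↑ʳy⁆∪p++q y _ _)) li

  LiftIndep-⊥⇔ : ∀ {m a I} → LiftIndep a I (⊥ {m}) ⇔ LiftIndep a I []
  LiftIndep-⊥⇔ {m} {a} {I} = mk⇔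
    (λ (iI , bound) → iI , subst (λ s → ∣ I ∣ + s ≤ rank M I + a) (∣⊥∣≡0 m) bound)
    (λ (iI , bound) → iI , subst (λ s → ∣ I ∣ + s ≤ rank M I + a) (sym (∣⊥∣≡0 m)) bound)

  LiftIndep-⊤⇔ : ∀ {m j I} → LiftIndep (m + j) I (⊤ {m}) ⇔ LiftIndep j I []
  LiftIndep-⊤⇔ {m} {j} {I} = mk⇔
    (λ (iI , bound) → iI , subst (_≤ rank M I + j) (sym (+-identityʳ ∣ I ∣)) (+-cancelʳ-≤ m _ _
      (subst₂ _≤_ (cong (∣ I ∣ +_) (∣⊤∣≡n m)) (x∙yz≈xz∙y (rank M I) m j) bound)))
    (λ (iI , bound) → iI , subst₂ _≤_ (cong (∣ I ∣ +_) (sym (∣⊤∣≡n m))) (sym (x∙yz≈xz∙y (rank M I) m j))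
      (+-monoˡ-≤ m (subst (_≤ rank M I + j) (+-identityʳ ∣ I ∣) bound)))

  higgsMajor-deletion : ∀ m j → DeletionIs (higgsMajor m j) (higgsLift (m + j))
  higgsMajor-deletion m j I = mk⇔
    (to (LiftIndep-⊥⇔ {m}) ∘ MajorIndep⇒LiftIndep)
    (LiftIndep⇒MajorIndep refl ∘ from (LiftIndep-⊥⇔ {m}))

  ⊤-isBasisOfX : ∀ m j → IsBasisOfX {n} {m} (higgsMajor m j) ⊤
  ⊤-isBasisOfX m j = LiftIndep⇒MajorIndep refl (from LiftIndep-⊤⇔ (LiftIndep-⊥ {0} j)) , λ _ _ _ → ⊆⊤

  higgsMajor-contraction : ∀ m j → ContractionIs (higgsMajor m j) (higgsLift j)
  higgsMajor-contraction m j I = mk⇔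
    (λ (B , (_ , maximal) , iIB) → to LiftIndep-⊤⇔ (subst (LiftIndep (m + j) I)
       (⊆-antisym ⊆⊤ (maximal ⊤ ⊆⊤ (proj₁ (⊤-isBasisOfX m j)))) (MajorIndep⇒LiftIndep iIB)))
    (λ li → ⊤ , ⊤-isBasisOfX m j , LiftIndep⇒MajorIndep refl (from LiftIndep-⊤⇔ li))

module ContractionDeletion {n k} (N : Matroid (n + k)) {L M : Matroid n}
             (contraction : ContractionIs N M) (deletion : DeletionIs N L) where

  extend-over-basis : ∀ {B p P J} → IsBasisOfX N B → Indep N (p ++ B) → p ⊆ P → Indep N J → J ⊆ P ++ ⊤ →
    Σ (Subset n) λ p′ → p′ ⊆ P × Indep N (p′ ++ B) × ∣ J ∣ ≤ ∣ p′ ∣ + ∣ B ∣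
  extend-over-basis {B} {p} {P} {J} (_ , maximal) iPB p⊆P iJ J⊆P⊤
    with Rank.extend N iPB iJ
  ... | K , pB⊆K , K⊆ , iK , ∣J∣≤∣K∣ = take n K , take⊆P , iK′ , ≤-trans ∣J∣≤∣K∣ (≤-reflexive ∣K∣≡)
    where
    K≡ : take n K ++ drop n K ≡ K
    K≡ = take++drop≡id n K
    take⊆P : take n K ⊆ P
    take⊆P = proj₁ (++-⊆⁻ ([ ++-mono-⊆ p⊆P ⊆⊤ , J⊆P⊤ ]′ ∘ x∈p∪q⁻ _ J ∘ K⊆ ∘ subst (_ ∈_) K≡))
    drop≡B : drop n K ≡ B
    drop≡B = ⊆-antisym
      (maximal (drop n K) (proj₂ (++-⊆⁻ (subst (_ ∈_) (sym K≡) ∘ pB⊆K)))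
        (indep-↓ N (subst (_ ∈_) K≡ ∘ ++-mono-⊆ {p = ⊥ {n}} {p′ = take n K} ⊥⊆ ⊆-refl) iK))
      (proj₂ (++-⊆⁻ (subst (_ ∈_) (sym K≡) ∘ pB⊆K)))
    iK′ : Indep N (take n K ++ B)
    iK′ = subst (Indep N) (trans (sym K≡) (cong (take n K ++_) drop≡B)) iK
    ∣K∣≡ : ∣ K ∣ ≡ ∣ take n K ∣ + ∣ B ∣
    ∣K∣≡ = trans (∣S∣≡∣take∣+∣drop∣ n K) (cong (∣ take n K ∣ +_) (cong ∣_∣ drop≡B))

  X : Subset (n + k)
  X = ⊥ {n} ++ ⊤

  ∣⊥++p∣≡∣p∣ : ∀ (p : Subset k) → ∣ ⊥ {n} ++ p ∣ ≡ ∣ p ∣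
  ∣⊥++p∣≡∣p∣ p = trans (∣p++q∣≡∣p∣+∣q∣ (⊥ {n}) p) (cong (_+ ∣ p ∣) (∣⊥∣≡0 n))

  isBasisOfX⇒∣∣≡rank : ∀ {B} → IsBasisOfX N B → ∣ B ∣ ≡ rank N X
  isBasisOfX⇒∣∣≡rank {B} basis@(iB , _) = ≤-antisym
    (subst (_≤ rank N X) (∣⊥++p∣≡∣p∣ B) (indep-⊆⇒∣∣≤rank N (++-mono-⊆ {p = ⊥ {n}} ⊆-refl ⊆⊤) iB))
    (let T , T⊆ , iT , ∣T∣≡rank = rank-witness N X
         p′ , p′⊆⊥ , _ , ∣T∣≤ = extend-over-basis basis iB ⊆-refl iT T⊆
         ∣p′∣≡0 = n≤0⇒n≡0 (≤-trans (p⊆q⇒∣p∣≤∣q∣ p′⊆⊥) (≤-reflexive (∣⊥∣≡0 n)))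
     in subst₂ _≤_ ∣T∣≡rank (cong (_+ ∣ B ∣) ∣p′∣≡0) ∣T∣≤)

  contraction-rank : ∀ I → rank M I + rank N X ≡ rank N (I ++ ⊤)
  contraction-rank I = ≤-antisym
    (let T , T⊆I , iT , ∣T∣≡rank = rank-witness M I
         B , basis , iTB = from (contraction T) iT
     in subst (_≤ rank N (I ++ ⊤))
              (trans (∣p++q∣≡∣p∣+∣q∣ T B) (cong₂ _+_ ∣T∣≡rank (isBasisOfX⇒∣∣≡rank basis)))
              (indep-⊆⇒∣∣≤rank N (++-mono-⊆ {q = B} T⊆I ⊆⊤) iTB))
    (let B , basis@(iB , _) , _ = from (contraction (⊥ {n})) (indep-⊥ M)
         T , T⊆ , iT , ∣T∣≡rank = rank-witness N (I ++ ⊤)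
         p′ , p′⊆I , ip′B , ∣T∣≤ = extend-over-basis basis iB ⊥⊆ iT T⊆
     in subst₂ _≤_ ∣T∣≡rank (cong (rank M I +_) (isBasisOfX⇒∣∣≡rank basis))
          (≤-trans ∣T∣≤ (+-monoˡ-≤ ∣ B ∣
            (indep-⊆⇒∣∣≤rank M p′⊆I (to (contraction p′) (B , basis , ip′B))))))

  deletion-rank : ∀ I → rank L I ≡ rank N (I ++ ⊥ {k})
  deletion-rank I = ≤-antisym
    (let T , T⊆I , iT , ∣T∣≡rank = rank-witness L I
     in subst (_≤ rank N (I ++ ⊥)) (trans (∣p++q∣≡∣p∣+∣q∣ T ⊥) (trans (cong (∣ T ∣ +_) (∣⊥∣≡0 k))
                                       (trans (+-identityʳ _) ∣T∣≡rank)))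
              (indep-⊆⇒∣∣≤rank N (++-mono-⊆ {q = ⊥ {k}} T⊆I ⊆-refl) (from (deletion T) iT)))
    (let T , T⊆ , iT , ∣T∣≡rank = rank-witness N (I ++ ⊥)
         T≡ = take++drop≡id n T
         take⊆I , drop⊆⊥ = ++-⊆⁻ (T⊆ ∘ subst (_ ∈_) T≡)
         drop≡⊥ = ⊆-antisym drop⊆⊥ ⊥⊆
         itake = to (deletion (take n T)) (subst (Indep N) (trans (sym T≡) (cong (take n T ++_) drop≡⊥)) iT)
         ∣T∣≡∣take∣ = trans (∣S∣≡∣take∣+∣drop∣ n T)
                     (trans (cong (λ D → ∣ take n T ∣ + ∣ D ∣) drop≡⊥) (cong (∣ take n T ∣ +_) (∣⊥∣≡0 k)))
     in subst (_≤ rank L I) (trans (sym (+-identityʳ _)) (trans (sym ∣T∣≡∣take∣) ∣T∣≡rank))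
              (indep-⊆⇒∣∣≤rank L take⊆I itake))

  closure-included : ClosureIncluded L M
  closure-included {e} {S} e∈clL = +-cancelʳ-≤ (rank N X) _ _ (begin
    rank M (⁅ e ⁆ ∪ S) + rank N X    ≡⟨ contraction-rank (⁅ e ⁆ ∪ S) ⟩
    rank N ((⁅ e ⁆ ∪ S) ++ ⊤)        ≡⟨ cong (rank N) (⁅x↑ˡ⁆∪p++q e S ⊤) ⟨
    rank N (⁅ e ↑ˡ k ⁆ ∪ (S ++ ⊤))   ≤⟨ Rank.∈cl-mono N (++-mono-⊆ {p = S} ⊆-refl ⊆⊤) e↑∈cl ⟩
    rank N (S ++ ⊤)                  ≡⟨ contraction-rank S ⟨
    rank M S + rank N X              ∎)
    where
    open ≤-Reasoning
    e↑∈cl : Rank._∈cl_ N (e ↑ˡ k) (S ++ ⊥)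
    e↑∈cl = begin
      rank N (⁅ e ↑ˡ k ⁆ ∪ (S ++ ⊥))  ≡⟨ cong (rank N) (⁅x↑ˡ⁆∪p++q e S ⊥) ⟩
      rank N ((⁅ e ⁆ ∪ S) ++ ⊥)      ≡⟨ deletion-rank (⁅ e ⁆ ∪ S) ⟨
      rank L (⁅ e ⁆ ∪ S)             ≤⟨ e∈clL ⟩
      rank L S                       ≡⟨ deletion-rank S ⟩
      rank N (S ++ ⊥)                ∎

  quotient : Quotient L M k
  quotient = record
    { indep⇒indep = λ {I} iI → let _ , _ , iIB = from (contraction I) iI in
        to (deletion I) (indep-↓ N (++-mono-⊆ {p = I} ⊆-refl ⊥⊆) iIB)
    ; closure⊆    = closure-included
    ; ∣∣≤rank+d   = λ {I} iI → begin
        ∣ I ∣                  ≡⟨ Rank.indep⇒rank≡∣∣ L iI ⟨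
        rank L I               ≡⟨ deletion-rank I ⟩
        rank N (I ++ ⊥)        ≤⟨ Rank.rank-mono N (++-mono-⊆ {p = I} ⊆-refl ⊆⊤) ⟩
        rank N (I ++ ⊤)        ≡⟨ contraction-rank I ⟨
        rank M I + rank N X    ≤⟨ +-monoʳ-≤ (rank M I) (Rank.rank≤∣∣ N X) ⟩
        rank M I + ∣ X ∣       ≡⟨ cong (rank M I +_) (trans (∣⊥++p∣≡∣p∣ ⊤) (∣⊤∣≡n k)) ⟩
        rank M I + k           ∎
    }
    where open ≤-Reasoning

HasMajor : ∀ {n} k → Matroid n → Matroid n → Set₁
HasMajor {n} k M L = Σ (Matroid (n + k)) λ N → ContractionIs N M × DeletionIs N L

SingleElementChain : ∀ {n} k → Matroid n → Matroid n → Set₁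
SingleElementChain {n} k M L = Σ (Fin (suc k) → Matroid n) λ Ls →
  (Ls zero ≅ M) × (Ls (fromℕ k) ≅ L) × ((i : Fin k) → HasMajor 1 (Ls (inject₁ i)) (Ls (fsuc i)))

module _ {d} {L M : Matroid n} (q : Quotient L M d) where
  open Higgs L M (closure⊆ q) using (higgsLift; higgsMajor; higgsMajor-contraction; higgsMajor-deletion)

  higgsLift-0≅ : higgsLift 0 ≅ M
  higgsLift-0≅ I = mk⇔
    (λ (_ , bound) → Rank.∣∣≤rank⇒indep M (subst₂ _≤_ (+-identityʳ _) (+-identityʳ _) bound))
    (λ iI → indep⇒indep q iI , subst₂ _≤_ (sym (+-identityʳ _)) (sym (+-identityʳ _))
                                        (≤-reflexive (sym (Rank.indep⇒rank≡∣∣ M iI))))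

  higgsLift-d≅ : higgsLift d ≅ L
  higgsLift-d≅ I = mk⇔ proj₁ (λ iI → iI , subst (_≤ rank M I + d) (sym (+-identityʳ _)) (∣∣≤rank+d q iI))

  quotient⇒major : HasMajor d M L
  quotient⇒major =
    higgsMajor d 0 ,
    (λ I → higgsLift-0≅ I ⇔-∘ higgsMajor-contraction d 0 I) ,
    (λ I → subst (λ t → higgsLift t ≅ L) (sym (+-identityʳ d)) higgsLift-d≅ I
             ⇔-∘ higgsMajor-deletion d 0 I)

  quotient⇒chain : SingleElementChain d M L
  quotient⇒chain =
    higgsLift ∘ toℕ ,
    higgsLift-0≅ ,
    subst (λ t → higgsLift t ≅ L) (sym (toℕ-fromℕ d)) higgsLift-d≅ ,
    λ i → higgsMajor 1 (toℕ i) ,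
          subst (ContractionIs (higgsMajor 1 (toℕ i)) ∘ higgsLift) (sym (toℕ-inject₁ i))
                (higgsMajor-contraction 1 (toℕ i)) ,
          higgsMajor-deletion 1 (toℕ i)

major⇒quotient : ∀ {n} k {M L : Matroid n} → HasMajor k M L → Quotient L M k
major⇒quotient k (N , contraction , deletion) = ContractionDeletion.quotient N contraction deletion

chain⇒quotient : ∀ {n} k {M L : Matroid n} → SingleElementChain k M L → Quotient L M k
chain⇒quotient k (Ls , Ls₀≅M , Lsₖ≅L , steps) =
  Quotient-resp-≅ Lsₖ≅L Ls₀≅M (Quotient-chain k Ls (major⇒quotient 1 ∘ steps))

theorem3 : (n k : ℕ) → n ≥ 1 → k ≥ 1 → (M L : Matroid n) →
    (Σ (Matroid (n + k)) λ N → ContractionIs N M × DeletionIs N L)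
    ⇔
    (Σ (Fin (suc k) → Matroid n) λ Ls →
       (Ls zero ≅ M) × (Ls (fromℕ k) ≅ L) ×
       ((i : Fin k) → Σ (Matroid (n + 1)) λ Nᵢ →
          ContractionIs Nᵢ (Ls (inject₁ i)) × DeletionIs Nᵢ (Ls (fsuc i))))
theorem3 n k _ _ M L =
  mk⇔ (quotient⇒chain {L = L} {M} ∘ major⇒quotient k) (quotient⇒major {L = L} {M} ∘ chain⇒quotient k)
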